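{- For integers $a\ge1$, $b\ge0$, the hook partition $\lambda=(a,1^b)$ satisfies $c^\lambda_{sp}(u)\neq 0$ for all cells $u\in\lambda$ if and only if $a=b$.
   Context: The notation $(a,1^b)$ denotes the partition with one part $a$ followed by $b$ parts equal to $1$. For a partition $\lambda$ with conjugate $\lambda'$ (cells $(i,j)$ = row $i$, column $j$ of the Young diagram; $\lambda_i=0$ beyond the length), the symplectic content of a cell $(i,j)\in\lambda$ is $c^\lambda_{sp}(i,j)=\lambda_i+\lambda_j-i-j+2$ if $i>j$, and $c^\lambda_{sp}(i,j)=i+j-\lambda'_i-\lambda'_j$ if $i\le j$. -}

module Defs where

open import Data.Nat using (ℕ; zero; suc; _+_; _≤_; _≤?_)
open import Data.List using (List; []; _∷_; length; filter; replicate)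
open import Data.Integer using (ℤ; +_; _-_)
open import Data.Product using (_×_)
open import Relation.Nullary using (yes; no)

-- A partition is a list of parts (weakly decreasing, positive).
Partition : Set
Partition = List ℕ

-- λ_i with 1-based row index i; 0 beyond the length (and for i = 0).
part : Partition → ℕ → ℕ
part []       _             = 0
part (x ∷ xs) zero          = 0
part (x ∷ xs) (suc zero)    = x
part (x ∷ xs) (suc (suc n)) = part xs (suc n)

conj : Partition → ℕ → ℕ
conj l j = length (filter (j ≤?_) l)

Cell : Partition → ℕ → ℕ → Set
Cell l i j = (1 ≤ i) × (1 ≤ j) × (j ≤ part l i)

csp : Partition → ℕ → ℕ → ℤ
csp l i j with i ≤? j
... | yes _ = + (i + j) - + (conj l i + conj l j)
... | no  _ = (+ (part l i + part l j + 2)) - + (i + j)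

hook : ℕ → ℕ → Partition
hook a b = a ∷ replicate b 1

-- The cells of (a , 1^b) are the arm (1 , 1 + j), j < a, and the leg (2 + m , 1), m < b.
-- Since λ'_1 = b + 1 and λ'_j = 1 on the rest of the arm, the content of (1 , 1 + j) is
-- −2b for j = 0 and j − b otherwise, so it vanishes exactly when j = b; the content of
-- (2 + m , 1) is a − m. Hence a zero content exists iff b < a (on the arm) or a < b (on the leg).
module Submission where

open import Defs
open import Data.Nat using (ℕ; _≤_)
open import Data.Integer using (0ℤ)
open import Relation.Binary.PropositionalEquality using (_≡_; _≢_)
open import Function.Bundles using (_⇔_)

open import Data.Nat using (zero; suc; pred; _+_; _<_; z≤n; s≤s; _≤?_)
open import Data.Nat.Properties using (≤-antisym; ≤-trans; <-irrefl; <-cmp; +-comm; +-suc; +-cancelʳ-≡; suc-injective)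
open import Data.Integer using (+_; _-_)
open import Data.Integer.Properties using (+-injective; i-j≡0⇒i≡j; i≡j⇒i-j≡0)
open import Data.List using (_∷_; replicate; length)
open import Data.List.Properties using (filter-accept)
open import Data.Product using (_×_; _,_)
open import Relation.Binary.Definitions using (tri<; tri≈; tri>)
open import Relation.Binary.PropositionalEquality using (refl; sym; trans; cong; cong₂)
open import Data.Empty using (⊥-elim)
open import Function.Base using (_∘_)
open import Function.Bundles using (mk⇔; Equivalence)
open import Function.Construct.Composition using (_⇔-∘_)

data HookCell (a b : ℕ) : ℕ → ℕ → Set where
  arm : ∀ {j} → j < a → HookCell a b 1 (suc j)
  leg : ∀ {m} → m < b → HookCell a b (suc (suc m)) 1

part-replicate : ∀ {b m} → m < b → part (replicate b 1) (suc m) ≡ 1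
part-replicate {suc b} {zero}  _         = refl
part-replicate {suc b} {suc m} (s≤s m<b) = part-replicate m<b

≤-part-replicate : ∀ b m {j} → 1 ≤ j → j ≤ part (replicate b 1) (suc m) → j ≡ 1 × m < b
≤-part-replicate zero    m       (s≤s _) ()
≤-part-replicate (suc b) zero    1≤j j≤1 = ≤-antisym j≤1 1≤j , s≤s z≤n
≤-part-replicate (suc b) (suc m) 1≤j j≤p with ≤-part-replicate b m 1≤j j≤p
... | j≡1 , m<b = j≡1 , s≤s m<b

HookCell⇒Cell : ∀ {a b i j} → HookCell a b i j → Cell (hook a b) i j
HookCell⇒Cell (arm j<a) = s≤s z≤n , s≤s z≤n , j<a
HookCell⇒Cell {b = b} (leg m<b) rewrite part-replicate {b} m<b = s≤s z≤n , s≤s z≤n , s≤s z≤n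

Cell⇒HookCell : ∀ {a b} i j → Cell (hook a b) i j → HookCell a b i j
Cell⇒HookCell (suc zero)    (suc j) (_ , _ , j<a) = arm j<a
Cell⇒HookCell {b = b} (suc (suc m)) j (_ , 1≤j , j≤p) with ≤-part-replicate b m 1≤j j≤p
... | refl , m<b = leg m<b

conj-replicate-1 : ∀ b → conj (replicate b 1) 1 ≡ b
conj-replicate-1 zero    = refl
conj-replicate-1 (suc b) = cong suc (conj-replicate-1 b)

conj-replicate-2+ : ∀ b k → conj (replicate b 1) (suc (suc k)) ≡ 0
conj-replicate-2+ zero    k = refl
conj-replicate-2+ (suc b) k = conj-replicate-2+ b k

conj-∷ : ∀ {x} l {j} → j ≤ x → conj (x ∷ l) j ≡ suc (conj l j)
conj-∷ l {j} j≤x = cong length (filter-accept (j ≤?_) {xs = l} j≤x)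

csp-hook-corner : ∀ {a} b → 1 ≤ a → csp (hook a b) 1 1 ≡ + 2 - + (suc b + suc b)
csp-hook-corner b 1≤a = cong (λ c → + 2 - + (c + c)) (trans (conj-∷ _ 1≤a) (cong suc (conj-replicate-1 b)))

csp-hook-arm : ∀ {a} b {k} → suc (suc k) ≤ a → csp (hook a b) 1 (suc (suc k)) ≡ + (3 + k) - + (suc b + 1)
csp-hook-arm b {k} 2+k≤a = cong₂ (λ c d → + (3 + k) - + (c + d))
  (trans (conj-∷ _ (≤-trans (s≤s z≤n) 2+k≤a)) (cong suc (conj-replicate-1 b)))
  (trans (conj-∷ _ 2+k≤a) (cong suc (conj-replicate-2+ b k)))

csp-hook-leg : ∀ a {b m} → m < b → csp (hook a b) (suc (suc m)) 1 ≡ + (suc a + 2) - + (suc (suc m) + 1)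
csp-hook-leg a {b} {m} m<b = cong (λ p → + (p + a + 2) - + (suc (suc m) + 1)) (part-replicate {b} m<b)

+m-+n≡0⇔m≡n : ∀ m n → (+ m - + n ≡ 0ℤ) ⇔ (m ≡ n)
+m-+n≡0⇔m≡n m n = mk⇔ (+-injective ∘ i-j≡0⇒i≡j (+ m) (+ n)) (i≡j⇒i-j≡0 ∘ cong (+_))

2≡[1+b]+[1+b]⇔0≡b : ∀ b → (2 ≡ suc b + suc b) ⇔ (0 ≡ b)
2≡[1+b]+[1+b]⇔0≡b b = mk⇔ (to b) λ { refl → refl }
  where
  to : ∀ b → 2 ≡ suc b + suc b → 0 ≡ b
  to zero    _ = refl
  to (suc c) e with trans (cong (pred ∘ pred) e) (+-suc c (suc c))
  ... | ()

3+k≡[1+b]+1⇔1+k≡b : ∀ k b → (3 + k ≡ suc b + 1) ⇔ (suc k ≡ b)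
3+k≡[1+b]+1⇔1+k≡b k b = mk⇔
  (λ e → suc-injective (trans (suc-injective e) (+-comm b 1)))
  (λ { refl → cong suc (+-comm 1 b) })

[1+a]+2≡[2+m]+1⇔m≡a : ∀ a m → (suc a + 2 ≡ suc (suc m) + 1) ⇔ (m ≡ a)
[1+a]+2≡[2+m]+1⇔m≡a a m = mk⇔
  (λ e → sym (+-cancelʳ-≡ 3 a m (trans (+-suc a 2) (trans e [2+m]+1≡m+3))))
  (λ { refl → trans (sym (+-suc m 2)) (sym [2+m]+1≡m+3) })
  where
  [2+m]+1≡m+3 : suc (suc m) + 1 ≡ m + 3
  [2+m]+1≡m+3 = trans (sym (+-suc (suc m) 1)) (sym (+-suc m 2))

csp-arm≡0⇔ : ∀ {a} b {j} → j < a → (csp (hook a b) 1 (suc j) ≡ 0ℤ) ⇔ (j ≡ b)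
csp-arm≡0⇔ b {zero} 0<a rewrite csp-hook-corner b 0<a =
  2≡[1+b]+[1+b]⇔0≡b b ⇔-∘ +m-+n≡0⇔m≡n 2 (suc b + suc b)
csp-arm≡0⇔ b {suc k} 1+k<a rewrite csp-hook-arm b 1+k<a =
  3+k≡[1+b]+1⇔1+k≡b k b ⇔-∘ +m-+n≡0⇔m≡n (3 + k) (suc b + 1)

csp-leg≡0⇔ : ∀ a {b m} → m < b → (csp (hook a b) (suc (suc m)) 1 ≡ 0ℤ) ⇔ (m ≡ a)
csp-leg≡0⇔ a {m = m} m<b rewrite csp-hook-leg a m<b =
  [1+a]+2≡[2+m]+1⇔m≡a a m ⇔-∘ +m-+n≡0⇔m≡n (suc a + 2) (suc (suc m) + 1)

corollary2p5 : (a b : ℕ) → 1 ≤ a →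
    ((∀ i j → Cell (hook a b) i j → csp (hook a b) i j ≢ 0ℤ) ⇔ (a ≡ b))
corollary2p5 a b _ = mk⇔ no-zero⇒a≡b λ { refl → a≡b⇒no-zero }
  where
  no-zero⇒a≡b : (∀ i j → Cell (hook a b) i j → csp (hook a b) i j ≢ 0ℤ) → a ≡ b
  no-zero⇒a≡b nz with <-cmp a b
  ... | tri< a<b _ _ = ⊥-elim (nz _ 1 (HookCell⇒Cell {a} {b} (leg a<b)) (Equivalence.from (csp-leg≡0⇔ a a<b) refl))
  ... | tri≈ _ a≡b _ = a≡b
  ... | tri> _ _ b<a = ⊥-elim (nz 1 _ (HookCell⇒Cell {a} {b} (arm b<a)) (Equivalence.from (csp-arm≡0⇔ b b<a) refl))

  a≡b⇒no-zero : ∀ i j → Cell (hook a a) i j → csp (hook a a) i j ≢ 0ℤ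
  a≡b⇒no-zero i j c with Cell⇒HookCell i j c
  ... | arm j<a = λ z → <-irrefl (Equivalence.to (csp-arm≡0⇔ a j<a) z) j<a
  ... | leg m<a = λ z → <-irrefl (Equivalence.to (csp-leg≡0⇔ a m<a) z) m<a
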